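{- For any positive integers $1 \leq p < q$, there exists a connected graph $G$ with $dem(G)=p$ and $meg(G)=q$.
   Context: All graphs are finite and simple. A pair of vertices $u,v$ (or any vertex set containing them) monitors an edge $e$ if $e$ lies on every shortest $u$–$v$ path. A monitoring edge-geodetic set (MEG-set) of $G$ is a set $M\subseteq V(G)$ such that every edge of $G$ is monitored by some pair of vertices of $M$; $meg(G)$ is the minimum size of an MEG-set. A distance edge-monitoring set of $G$ is a set $S\subseteq V(G)$ such that for every edge $e$ of $G$ there exist $x\in S$ and $y\in V(G)$ such that $e$ lies on every shortest $x$–$y$ path; $dem(G)$ is the minimum size of a distance edge-monitoring set. -}

module Defs where

open import Data.Nat using (ℕ; zero; suc; _≤_)
open import Data.Bool using (Bool; true; false)
open import Data.Fin using (Fin)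
open import Data.Fin.Subset using (Subset; _∈_; ∣_∣)
open import Data.Product using (Σ; ∃; ∃-syntax; _×_; _,_)
open import Data.Sum using (_⊎_)
open import Relation.Binary.PropositionalEquality using (_≡_)

record Graph (n : ℕ) : Set where
  field
    adj     : Fin n → Fin n → Bool
    adj-sym : ∀ u v → adj u v ≡ adj v u
    irrefl  : ∀ u → adj u u ≡ false

open Graph public

module _ {n : ℕ} (G : Graph n) where

  Adj : Fin n → Fin n → Set
  Adj u v = adj G u v ≡ true

  data Walk : Fin n → Fin n → ℕ → Set where
    nil  : ∀ {u} → Walk u u 0
    cons : ∀ {u w v k} → Adj u w → Walk w v k → Walk u v (suc k)

  data OnWalk (a b : Fin n) : ∀ {u v k} → Walk u v k → Set where
    here  : ∀ {u w v k} (e : Adj u w) (p : Walk w v k) →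
            (u ≡ a × w ≡ b) ⊎ (u ≡ b × w ≡ a) → OnWalk a b (cons e p)
    there : ∀ {u w v k} (e : Adj u w) (p : Walk w v k) →
            OnWalk a b p → OnWalk a b (cons e p)

  -- A shortest u–v path: a u–v walk of minimum length
  -- (minimum-length walks are automatically paths).
  IsShortest : ∀ {u v k} → Walk u v k → Set
  IsShortest {u} {v} {k} _ = ∀ k' → Walk u v k' → k ≤ k'

  Connected : Set
  Connected = ∀ u v → ∃[ k ] Walk u v k

  Monitors : Fin n → Fin n → Fin n → Fin n → Set
  Monitors x y a b = ∀ k (p : Walk x y k) → IsShortest p → OnWalk a b p

  IsMEGSet : Subset n → Set
  IsMEGSet M = ∀ a b → Adj a b →
    ∃[ x ] ∃[ y ] (x ∈ M × y ∈ M × Monitors x y a b)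

  IsDEMSet : Subset n → Set
  IsDEMSet S = ∀ a b → Adj a b →
    ∃[ x ] ∃[ y ] (x ∈ S × Monitors x y a b)

  MegIs : ℕ → Set
  MegIs m = (∃[ M ] (IsMEGSet M × ∣ M ∣ ≡ m)) × (∀ M → IsMEGSet M → m ≤ ∣ M ∣)

  DemIs : ℕ → Set
  DemIs m = (∃[ S ] (IsDEMSet S × ∣ S ∣ ≡ m)) × (∀ S → IsDEMSet S → m ≤ ∣ S ∣)

{-# OPTIONS --safe #-}

-- The witness is the cone over K_p ⊔ (q − p)·K₁: a clique K_{p+1} with q − p pendant vertices
-- attached to one of its vertices, the apex (vertex zero).  Two non-adjacent vertices are joined
-- through the apex, so a pair monitors either its own edge or one of the two apex edges on that
-- route.  Hence an apex edge az is monitored only by pairs containing z, which forces all q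
-- non-apex vertices into an MEG-set; they suffice, since each of them has a partner whose only
-- common neighbour with it is the apex.  For dem, the p clique vertices suffice.  Conversely a
-- clique edge is monitored only from one of its ends, so a distance edge-monitoring set S misses
-- at most one clique vertex i; the edge ai then cannot be monitored from a clique vertex (which
-- sees i directly), so S pays for i with the apex or a pendant vertex.

module Submission where

open import Defs
open import Data.Nat using (ℕ; _≤_; _<_; zero; suc; z≤n; s≤s; s≤s⁻¹)
open import Data.Nat.Properties using (≤-trans)
open import Data.Product using (Σ; ∃-syntax; _×_; _,_; proj₁; proj₂)
open import Data.Sum using (_⊎_; inj₁; inj₂)
open import Data.Bool using (Bool; true; false; _∧_; not)
open import Data.Bool.Properties using (∧-comm; ∧-zeroʳ; ∨-zeroʳ) renaming (_≟_ to _≟ᵇ_)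
open import Data.Fin using (Fin; zero; suc; _≟_)
open import Data.Fin.Properties using (any?)
open import Data.Fin.Subset
  using (Subset; inside; outside; _∈_; _∉_; _⊆_; _⊂_; _∪_; ⁅_⁆; ⊤; ⊥; ∣_∣)
open import Data.Fin.Subset.Properties
  using (_∈?_; ∈⊤; ∣⊤∣≡n; ∣⊥∣≡0; ∣p∣≤∣x∷p∣; p⊆q⇒∣p∣≤∣q∣; p⊂q⇒∣p∣<∣q∣; x∈⁅x⁆;
         p⊆p∪q; x∈p∪q⁺; ∪-identityʳ)
open import Data.Vec using (_∷_; lookup; here; there)
open import Data.Vec.Properties using ([]=⇒lookup; lookup⇒[]=)
open import Function using (_∘_; mk⇔)
open import Relation.Binary.PropositionalEquality using (_≡_; _≢_; refl; sym; trans; cong; cong₂; subst)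
open import Relation.Nullary using (¬_; Dec; yes; no; does; ¬?; _×-dec_)
open import Relation.Nullary.Decidable using (dec-true; dec-false; does-⇔; decidable-stable)
open import Data.Empty using (⊥-elim)

SameEdge : ∀ {n} → Fin n → Fin n → Fin n → Fin n → Set
SameEdge x y a b = (x ≡ a × y ≡ b) ⊎ (x ≡ b × y ≡ a)

module _ {n : ℕ} {G : Graph n} where

  private variable
    x y a b w : Fin n

  adjacent? : ∀ x y → Dec (Adj G x y)
  adjacent? x y = adj G x y ≟ᵇ true

  adj⇒≢ : Adj G x y → x ≢ y
  adj⇒≢ {x} xy refl with () ← trans (sym xy) (irrefl G x)

  edge : Adj G x y → Walk G x y 1
  edge xy = cons xy nil

  path₂ : Adj G x w → Adj G w y → Walk G x y 2
  path₂ xw wy = cons xw (cons wy nil)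

  onWalk-flip : ∀ {k} {p : Walk G x y k} → OnWalk G a b p → OnWalk G b a p
  onWalk-flip (here e p (inj₁ ab)) = here e p (inj₂ ab)
  onWalk-flip (here e p (inj₂ ba)) = here e p (inj₁ ba)
  onWalk-flip (there e p q)        = there e p (onWalk-flip q)

  monitors-flip : Monitors G x y a b → Monitors G x y b a
  monitors-flip mon k p p-shortest = onWalk-flip (mon k p p-shortest)

  ¬monitors-self : ¬ Monitors G x x a b
  ¬monitors-self mon with () ← mon 0 nil (λ _ _ → z≤n)

  edge-isShortest : (xy : Adj G x y) → IsShortest G (edge xy)
  edge-isShortest xy zero    nil = ⊥-elim (adj⇒≢ xy refl)
  edge-isShortest xy (suc _) _   = s≤s z≤n

  monitors-own-edge : Adj G x y → Monitors G x y x y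
  monitors-own-edge xy _ nil                  _          = ⊥-elim (adj⇒≢ xy refl)
  monitors-own-edge xy _ (cons e nil)         _          = here e nil (inj₁ (refl , refl))
  monitors-own-edge xy _ (cons _ (cons _ _)) p-shortest with s≤s () ← p-shortest 1 (edge xy)

  monitors⇒sameEdge : Adj G x y → Monitors G x y a b → SameEdge x y a b
  monitors⇒sameEdge xy mon with mon 1 (edge xy) (edge-isShortest xy)
  ... | here _ _ xy≡ab = xy≡ab

  path₂-isShortest : x ≢ y → ¬ Adj G x y → (p : Walk G x y 2) → IsShortest G p
  path₂-isShortest x≢y _   _ zero          nil          = ⊥-elim (x≢y refl)
  path₂-isShortest _   x≁y _ (suc zero)    (cons xy nil) = ⊥-elim (x≁y xy)
  path₂-isShortest _   _   _ (suc (suc _)) _             = s≤s (s≤s z≤n)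

  onPath₂⁻ : {xw : Adj G x w} {wy : Adj G w y} →
             OnWalk G a b (path₂ xw wy) → SameEdge x w a b ⊎ SameEdge w y a b
  onPath₂⁻ (here _ _ xw≡ab)             = inj₁ xw≡ab
  onPath₂⁻ (there _ _ (here _ _ wy≡ab)) = inj₂ wy≡ab

  monitors-via-path₂ : x ≢ y → ¬ Adj G x y → Adj G x w → Adj G w y →
                       Monitors G x y a b → SameEdge x w a b ⊎ SameEdge w y a b
  monitors-via-path₂ x≢y x≁y xw wy mon =
    onPath₂⁻ (mon 2 (path₂ xw wy) (path₂-isShortest x≢y x≁y (path₂ xw wy)))

  onShortest-via-unique-midpoint :
    x ≢ y → ¬ Adj G x y → Adj G x w → Adj G w y →
    (∀ {v} → Adj G x v → Adj G v y → v ≡ w) →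
    ∀ k (p : Walk G x y k) → IsShortest G p → OnWalk G x w p × OnWalk G w y p
  onShortest-via-unique-midpoint x≢y _ _ _ _ _ nil _ = ⊥-elim (x≢y refl)
  onShortest-via-unique-midpoint _ x≁y _ _ _ _ (cons xy nil) _ = ⊥-elim (x≁y xy)
  onShortest-via-unique-midpoint _ _ _ _ unique _ (cons xv (cons vy nil)) _ with refl ← unique xv vy =
    here xv _ (inj₁ (refl , refl)) , there xv _ (here vy nil (inj₁ (refl , refl)))
  onShortest-via-unique-midpoint _ _ xw wy _ _ (cons _ (cons _ (cons _ _))) p-shortest
    with s≤s (s≤s ()) ← p-shortest 2 (path₂ xw wy)

  unique-midpoint-monitors :
    x ≢ y → ¬ Adj G x y → Adj G x w → Adj G w y →
    (∀ {v} → Adj G x v → Adj G v y → v ≡ w) →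
    Monitors G x y x w × Monitors G x y w y
  unique-midpoint-monitors x≢y x≁y xw wy unique =
    (λ k p p-shortest → proj₁ (onShortest-via-unique-midpoint x≢y x≁y xw wy unique k p p-shortest)) ,
    (λ k p p-shortest → proj₂ (onShortest-via-unique-midpoint x≢y x≁y xw wy unique k p p-shortest))

∣p∪⁅x⁆∣≤1+∣p∣ : ∀ {n} (p : Subset n) x → ∣ p ∪ ⁅ x ⁆ ∣ ≤ suc ∣ p ∣
∣p∪⁅x⁆∣≤1+∣p∣ (s ∷ p)     zero    rewrite ∨-zeroʳ s | ∪-identityʳ p = s≤s (∣p∣≤∣x∷p∣ s p)
∣p∪⁅x⁆∣≤1+∣p∣ (true ∷ p)  (suc x) = s≤s (∣p∪⁅x⁆∣≤1+∣p∣ p x)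
∣p∪⁅x⁆∣≤1+∣p∣ (false ∷ p) (suc x) = ∣p∪⁅x⁆∣≤1+∣p∣ p x

∣p∣≤∣q∣-by-exchange : ∀ {n} (p q : Subset n) →
  (∀ {y z} → y ∈ p → z ∈ p → y ≢ z → y ∈ q ⊎ z ∈ q) →
  (∀ {y} → y ∈ p → y ∉ q → ∃[ x ] (x ∈ q × x ∉ p)) →
  ∣ p ∣ ≤ ∣ q ∣
∣p∣≤∣q∣-by-exchange p q covers compensates with any? (λ y → y ∈? p ×-dec ¬? (y ∈? q))
... | no nothing-missing =
  p⊆q⇒∣p∣≤∣q∣ λ {y} y∈p → decidable-stable (y ∈? q) (λ y∉q → nothing-missing (y , y∈p , y∉q))
... | yes (y , y∈p , y∉q) with compensates y∈p y∉q
... | x , x∈q , x∉p = s≤s⁻¹ (≤-trans (p⊂q⇒∣p∣<∣q∣ p⊂q∪⁅y⁆) (∣p∪⁅x⁆∣≤1+∣p∣ q y))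
  where
  p⊆q∪⁅y⁆ : p ⊆ q ∪ ⁅ y ⁆
  p⊆q∪⁅y⁆ {z} z∈p with z ≟ y
  ... | yes refl = x∈p∪q⁺ (inj₂ (x∈⁅x⁆ y))
  ... | no z≢y with covers z∈p y∈p z≢y
  ...   | inj₁ z∈q = x∈p∪q⁺ (inj₁ z∈q)
  ...   | inj₂ y∈q = ⊥-elim (y∉q y∈q)
  p⊂q∪⁅y⁆ : p ⊂ q ∪ ⁅ y ⁆
  p⊂q∪⁅y⁆ = p⊆q∪⁅y⁆ , x , p⊆p∪q ⁅ y ⁆ x∈q , x∉p

subset-of-size : ∀ {r n} → r ≤ n → Σ (Subset n) (λ X → ∣ X ∣ ≡ r)
subset-of-size {zero}  {n}     _           = ⊥ , ∣⊥∣≡0 n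
subset-of-size {suc r} {suc n} (s≤s r≤n) with X , ∣X∣≡r ← subset-of-size r≤n =
  inside ∷ X , cong suc ∣X∣≡r

coneAdj : ∀ {m} → Graph m → Fin (suc m) → Fin (suc m) → Bool
coneAdj H zero    zero    = false
coneAdj H zero    (suc _) = true
coneAdj H (suc _) zero    = true
coneAdj H (suc x) (suc y) = adj H x y

cone : ∀ {m} → Graph m → Graph (suc m)
cone H = record { adj = coneAdj H ; adj-sym = coneAdj-sym ; irrefl = coneAdj-irrefl }
  where
  coneAdj-sym : ∀ u v → coneAdj H u v ≡ coneAdj H v u
  coneAdj-sym zero    zero    = refl
  coneAdj-sym zero    (suc _) = refl
  coneAdj-sym (suc _) zero    = refl
  coneAdj-sym (suc x) (suc y) = adj-sym H x y
  coneAdj-irrefl : ∀ u → coneAdj H u u ≡ false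
  coneAdj-irrefl zero    = refl
  coneAdj-irrefl (suc x) = irrefl H x

Isolated : ∀ {m} → Graph m → Fin m → Set
Isolated H v = ∀ w → ¬ Adj H w v

module _ {m : ℕ} {H : Graph m} where

  private variable
    x y a b : Fin (suc m)
    u v z : Fin m

  cone-connected : Connected (cone H)
  cone-connected zero    zero    = 0 , nil
  cone-connected zero    (suc _) = 1 , edge refl
  cone-connected (suc _) zero    = 1 , edge refl
  cone-connected (suc _) (suc _) = 2 , path₂ {w = zero} refl refl

  cone-monitors : Monitors (cone H) x y a b →
                  SameEdge x y a b ⊎ (SameEdge x zero a b ⊎ SameEdge zero y a b)
  cone-monitors {zero}  {zero}  mon = ⊥-elim (¬monitors-self mon)
  cone-monitors {zero}  {suc _} mon = inj₁ (monitors⇒sameEdge refl mon)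
  cone-monitors {suc _} {zero}  mon = inj₁ (monitors⇒sameEdge refl mon)
  cone-monitors {suc u} {suc v} mon with adjacent? {G = H} u v
  ... | yes uv = inj₁ (monitors⇒sameEdge uv mon)
  ... | no u≁v = inj₂ (monitors-via-path₂ (λ { refl → ¬monitors-self mon }) u≁v refl refl mon)

  cone-apexEdge-monitor : Monitors (cone H) x y zero (suc z) → x ≡ suc z ⊎ y ≡ suc z
  cone-apexEdge-monitor mon with cone-monitors mon
  ... | inj₁ (inj₁ (_ , y≡z))          = inj₂ y≡z
  ... | inj₁ (inj₂ (x≡z , _))          = inj₁ x≡z
  ... | inj₂ (inj₁ (inj₂ (x≡z , _)))   = inj₁ x≡z
  ... | inj₂ (inj₂ (inj₁ (_ , y≡z)))   = inj₂ y≡z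

  cone-apexEdge-monitor-≁ : Monitors (cone H) (suc u) y zero (suc z) → u ≢ z → ¬ Adj H u z
  cone-apexEdge-monitor-≁ mon u≢z uz with cone-apexEdge-monitor mon
  ... | inj₁ refl = u≢z refl
  ... | inj₂ refl with monitors⇒sameEdge uz mon
  ...   | inj₂ (refl , _) = u≢z refl

  cone-baseEdge-monitor : Monitors (cone H) x y (suc u) (suc v) → x ≡ suc u ⊎ x ≡ suc v
  cone-baseEdge-monitor mon with cone-monitors mon
  ... | inj₁ (inj₁ (x≡u , _)) = inj₁ x≡u
  ... | inj₁ (inj₂ (x≡v , _)) = inj₂ x≡v
  ... | inj₂ (inj₁ (inj₁ (_ , ())))
  ... | inj₂ (inj₁ (inj₂ (_ , ())))
  ... | inj₂ (inj₂ (inj₁ (() , _)))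
  ... | inj₂ (inj₂ (inj₂ (() , _)))

  cone-isolated-monitors : u ≢ v → Isolated H v →
    Monitors (cone H) (suc u) (suc v) (suc u) zero × Monitors (cone H) (suc u) (suc v) zero (suc v)
  cone-isolated-monitors {u = u} {v = v} u≢v v-isolated =
    unique-midpoint-monitors (λ { refl → u≢v refl }) (v-isolated u) refl refl apex-only
    where
    apex-only : ∀ {w} → Adj (cone H) (suc u) w → Adj (cone H) w (suc v) → w ≡ zero
    apex-only {zero}  _ _  = refl
    apex-only {suc w} _ wv = ⊥-elim (v-isolated w wv)

  cone-meg-lowerBound : ∀ M → IsMEGSet (cone H) M → m ≤ ∣ M ∣
  cone-meg-lowerBound M megSet = subst (_≤ ∣ M ∣) (∣⊤∣≡n m) (p⊆q⇒∣p∣≤∣q∣ nonApex⊆M)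
    where
    nonApex⊆M : outside ∷ ⊤ ⊆ M
    nonApex⊆M {suc z} _ with megSet zero (suc z) refl
    ... | _ , _ , x∈M , y∈M , mon with cone-apexEdge-monitor mon
    ...   | inj₁ refl = x∈M
    ...   | inj₂ refl = y∈M

cliqueOnAdj : ∀ {m} → Subset m → Fin m → Fin m → Bool
cliqueOnAdj C x y = (lookup C x ∧ lookup C y) ∧ not (does (x ≟ y))

cliqueOn : ∀ {m} → Subset m → Graph m
cliqueOn C = record
  { adj     = cliqueOnAdj C
  ; adj-sym = λ x y → cong₂ (λ b c → b ∧ not c) (∧-comm (lookup C x) (lookup C y))
                             (does-⇔ (mk⇔ sym sym) (x ≟ y) (y ≟ x))
  ; irrefl  = λ x → subst (λ c → (lookup C x ∧ lookup C x) ∧ not c ≡ false)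
                          (sym (dec-true (x ≟ x) refl)) (∧-zeroʳ _)
  }

module _ {m : ℕ} {C : Subset m} where

  private variable
    x y : Fin m

  cliqueOn-adj : x ∈ C → y ∈ C → x ≢ y → Adj (cliqueOn C) x y
  cliqueOn-adj {x} {y} x∈C y∈C x≢y rewrite []=⇒lookup x∈C | []=⇒lookup y∈C =
    cong not (dec-false (x ≟ y) x≢y)

  cliqueOn-adj⁻ : Adj (cliqueOn C) x y → x ∈ C × y ∈ C
  cliqueOn-adj⁻ {x} {y} xy with lookup C x in x∈C | lookup C y in y∈C
  ... | true | true = lookup⇒[]= x C x∈C , lookup⇒[]= y C y∈C

  cliqueOn-isolated : x ∉ C → Isolated (cliqueOn C) x
  cliqueOn-isolated x∉C _ wx = x∉C (proj₂ (cliqueOn-adj⁻ wx))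

module _ {m : ℕ} (C : Subset m) where

  private
    G : Graph (suc m)
    G = cone (cliqueOn C)

  cone-cliqueOn-demSet : ∀ {c} → c ∈ C → IsDEMSet G (outside ∷ C)
  cone-cliqueOn-demSet     c∈C zero    zero    ()
  cone-cliqueOn-demSet {c} c∈C zero    (suc z) _ with z ∈? C
  ... | yes z∈C = suc z , zero , there z∈C , monitors-flip (monitors-own-edge refl)
  ... | no z∉C  = suc c , suc z , there c∈C ,
                  proj₂ (cone-isolated-monitors (λ { refl → z∉C c∈C }) (cliqueOn-isolated z∉C))
  cone-cliqueOn-demSet     c∈C (suc z) zero    _ with cone-cliqueOn-demSet c∈C zero (suc z) refl
  ... | x , y , x∈D , mon = x , y , x∈D , monitors-flip mon
  cone-cliqueOn-demSet     c∈C (suc a) (suc b) ab =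
    suc a , suc b , there (proj₁ (cliqueOn-adj⁻ ab)) , monitors-own-edge ab

  cone-cliqueOn-dem-lowerBound : ∀ S → IsDEMSet G S → ∣ C ∣ ≤ ∣ S ∣
  cone-cliqueOn-dem-lowerBound S demSet = ∣p∣≤∣q∣-by-exchange (outside ∷ C) S covers compensates
    where
    covers : ∀ {y z} → y ∈ outside ∷ C → z ∈ outside ∷ C → y ≢ z → y ∈ S ⊎ z ∈ S
    covers {suc a} {suc b} (there a∈C) (there b∈C) a≢b
      with demSet (suc a) (suc b) (cliqueOn-adj a∈C b∈C (a≢b ∘ cong suc))
    ... | x , _ , x∈S , mon with cone-baseEdge-monitor mon
    ...   | inj₁ refl = inj₁ x∈S
    ...   | inj₂ refl = inj₂ x∈S
    compensates : ∀ {y} → y ∈ outside ∷ C → y ∉ S → ∃[ x ] (x ∈ S × x ∉ outside ∷ C)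
    compensates {suc i} (there i∈C) i∉S with demSet zero (suc i) refl
    ... | zero  , _ , apex∈S , _   = zero , apex∈S , λ ()
    ... | suc u , _ , u∈S    , mon = suc u , u∈S , λ { (there u∈C) →
      cone-apexEdge-monitor-≁ mon u≢i (cliqueOn-adj u∈C i∈C u≢i) }
      where
      u≢i : u ≢ i
      u≢i refl = i∉S u∈S

  cone-cliqueOn-dem : ∀ {c} → c ∈ C → DemIs G ∣ C ∣
  cone-cliqueOn-dem c∈C =
    (outside ∷ C , cone-cliqueOn-demSet c∈C , refl) , cone-cliqueOn-dem-lowerBound

  cone-cliqueOn-megSet : ∀ {c ℓ} → c ∈ C → ℓ ∉ C → IsMEGSet G (outside ∷ ⊤)
  cone-cliqueOn-megSet         c∈C ℓ∉C zero    zero    ()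
  cone-cliqueOn-megSet {c} {ℓ} c∈C ℓ∉C zero    (suc z) _ with z ∈? C
  ... | yes z∈C = suc z , suc ℓ , there ∈⊤ , there ∈⊤ ,
                  monitors-flip (proj₁ (cone-isolated-monitors (λ { refl → ℓ∉C z∈C })
                                                               (cliqueOn-isolated ℓ∉C)))
  ... | no z∉C  = suc c , suc z , there ∈⊤ , there ∈⊤ ,
                  proj₂ (cone-isolated-monitors (λ { refl → z∉C c∈C }) (cliqueOn-isolated z∉C))
  cone-cliqueOn-megSet         c∈C ℓ∉C (suc z) zero    _ with cone-cliqueOn-megSet c∈C ℓ∉C zero (suc z) refl
  ... | x , y , x∈M , y∈M , mon = x , y , x∈M , y∈M , monitors-flip mon
  cone-cliqueOn-megSet         c∈C ℓ∉C (suc a) (suc b) ab =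
    suc a , suc b , there ∈⊤ , there ∈⊤ , monitors-own-edge ab

  cone-cliqueOn-meg : ∀ {c ℓ} → c ∈ C → ℓ ∉ C → MegIs G m
  cone-cliqueOn-meg c∈C ℓ∉C =
    (outside ∷ ⊤ , cone-cliqueOn-megSet c∈C ℓ∉C , ∣⊤∣≡n m) , cone-meg-lowerBound

mainTheorem2 : ∀ (p q : ℕ) → 1 ≤ p → p < q →
    ∃[ n ] Σ (Graph n) (λ G → Connected G × DemIs G p × MegIs G q)
mainTheorem2 zero    _             ()  _
mainTheorem2 (suc p) (suc (suc m)) _   (s≤s (s≤s p≤m)) with X , ∣X∣≡p ← subset-of-size p≤m =
  _ , cone (cliqueOn C) , cone-connected ,
  subst (DemIs _) (cong suc ∣X∣≡p) (cone-cliqueOn-dem C here) ,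
  cone-cliqueOn-meg C here 1∉C
  where
  C : Subset (suc (suc m))
  C = inside ∷ outside ∷ X
  1∉C : suc zero ∉ C
  1∉C (there ())
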